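{- For all integers $i\ge0$, $j\ge0$, $r\ge0$, $$\left[{i \atop j}\right]_r=(-1)^{i-j}\,c_{i-r,j-r,r};$$ in particular $\left[{i \atop j}\right]_r=0$ for $i<r$ and $\left[{r \atop j}\right]_r=\delta_{j,r}$.
   Context: The signed Stirling numbers of the first kind $s_{i,r}$ are defined by $x(x-1)\cdots(x-i+1)=\sum_{r=0}^{i}s_{i,r}x^r$. For integers $i,j\ge0$ and real $k$, $c_{i,j,k}=\sum_{r=j}^{i}\binom{r}{j}(-k)^{r-j}s_{i,r}$ (zero if $j>i$), and $c_{i,j,k}=0$ whenever $i<0$ or $j<0$. The $r$-Stirling numbers of the first kind (Broder) $\left[{n \atop m}\right]_r$ (for integers $n,r\ge 0$ and integer $m$) are defined by: $\left[{n \atop m}\right]_r=0$ for $n<r$; $\left[{r \atop m}\right]_r=\delta_{m,r}$; and $\left[{n \atop m}\right]_r=(n-1)\left[{n-1 \atop m}\right]_r+\left[{n-1 \atop m-1}\right]_r$ for $n>r$. (Combinatorially, for $m\ge 0$ this is the number of permutations of $\{1,\dots,n\}$ with $m$ cycles in which $1,\dots,r$ lie in distinct cycles.) $\delta$ is the Kronecker delta. -}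

module Defs where

open import Data.Nat as ℕ using (ℕ; zero; suc; _<_)
open import Data.Nat.Combinatorics using (_C_)
open import Data.Integer using (ℤ; +_; -[1+_]; _+_; _*_; -_; _-_; 0ℤ; 1ℤ; _^_)
open import Data.List using (List; []; _∷_; map)
open import Data.Nat using (_≟_; _<?_; _∸_)
open import Relation.Nullary using (yes; no)

-- Polynomials with integer coefficients as coefficient lists (constant term first).
Poly : Set
Poly = List ℤ

coeff : Poly → ℕ → ℤ
coeff []       _       = 0ℤ
coeff (a ∷ p)  zero    = a
coeff (a ∷ p)  (suc r) = coeff p r

scale : ℤ → Poly → Poly
scale a = map (a *_)

addP : Poly → Poly → Poly
addP []       q        = q
addP p        []       = p
addP (a ∷ p)  (b ∷ q)  = (a + b) ∷ addP p q

mulXminus : ℤ → Poly → Poly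
mulXminus c p = addP (0ℤ ∷ p) (scale (- c) p)

falling : ℕ → Poly
falling zero    = 1ℤ ∷ []
falling (suc i) = mulXminus (+ i) (falling i)

-- signed Stirling numbers of the first kind: x(x-1)...(x-i+1) = Σ_r s i r x^r
s : ℕ → ℕ → ℤ
s i r = coeff (falling i) r

-- Σ_{r=a}^{b} f r
sumRange : ℕ → ℕ → (ℕ → ℤ) → ℤ
sumRange a b f = go (suc b ∸ a)
  where
  go : ℕ → ℤ
  go zero    = 0ℤ
  go (suc t) = go t + f (a ℕ.+ t)

cNat : ℕ → ℕ → ℤ → ℤ
cNat i j k with i <? j
... | yes _ = 0ℤ
... | no  _ = sumRange j i (λ r → (+ (r C j)) * ((- k) ^ (r ∸ j)) * s i r)

c : ℤ → ℤ → ℤ → ℤ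
c (+ i)     (+ j)     k = cNat i j k
c (+ i)     -[1+ _ ]  k = 0ℤ
c -[1+ _ ]  _         k = 0ℤ

δ : ℤ → ℤ → ℤ
δ a b with a Data.Integer.≟ b
... | yes _ = 1ℤ
... | no  _ = 0ℤ

-- Broder's r-Stirling numbers of the first kind  [n m]_r  (m an integer):
--   0 if n < r;  δ_{m,r} if n = r;  (n-1)[n-1 m]_r + [n-1 m-1]_r if n > r.
rStirling1 : ℕ → ℤ → ℕ → ℤ
rStirling1 zero    m r with r ≟ 0
... | yes _ = δ m (+ r)
... | no  _ = 0ℤ
rStirling1 (suc n) m r with suc n <? r | suc n ≟ r
... | yes _ | _     = 0ℤ
... | no  _ | yes _ = δ m (+ r)
... | no  _ | no  _ = (+ n) * rStirling1 n m r + rStirling1 n (m - 1ℤ) r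

signPow : ℤ → ℤ
signPow e with Data.Integer.∣ e ∣ ℕ.% 2
... | zero = 1ℤ
... | suc _ = - 1ℤ

-- The Stirling recurrence s_{a+1,r+1} = s_{a,r} - a s_{a,r+1} and Pascal's rule for the weights
-- C(r,j) (-k)^(r-j) give c_{a+1,j+1,k} = c_{a,j,k} - (k+a) c_{a,j+1,k}, i.e. multiplication of
-- (x-k)(x-k-1)⋯(x-k-a+1) by (x-k-a). For i = a+r, j = b+r and k = r this is, up to the sign
-- (-1)^(a+b), Broder's recurrence [a+r+1, b+r+1]_r = (a+r) [a+r, b+r+1]_r + [a+r, b+r]_r, and the
-- boundary values at a = 0 agree. When i < r or j < r both sides vanish.

module Submission where

open import Defs
open import Data.Nat as ℕ using (ℕ; zero; suc; _≤_; _<_; z≤n; s≤s; _<?_; _∸_)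
import Data.Nat.Properties as ℕP
open import Data.Nat.Combinatorics using (_C_; k>n⇒nCk≡0; nCk+nC[k+1]≡[n+1]C[k+1])
open import Data.Nat.DivMod using (_%_; [m+n]%n≡m%n; m%n<n)
open import Data.Integer as ℤ using (ℤ; +_; -[1+_]; _+_; _*_; -_; _-_; 0ℤ; 1ℤ; _^_; _⊖_; ∣_∣)
import Data.Integer.Properties as ℤP
open import Data.Integer.Tactic.RingSolver using (solve-∀)
open import Data.List using ([]; _∷_)
open import Data.Empty using (⊥-elim)
open import Data.Sum using (inj₁; inj₂)
open import Relation.Nullary using (yes; no; ¬_)
open import Relation.Binary.PropositionalEquality

sumBelow : ℕ → (ℕ → ℤ) → ℤ
sumBelow zero    f = 0ℤ
sumBelow (suc n) f = sumBelow n f + f n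

sumBelow-cong : ∀ n {f g : ℕ → ℤ} → (∀ r → f r ≡ g r) → sumBelow n f ≡ sumBelow n g
sumBelow-cong zero    f≗g = refl
sumBelow-cong (suc n) f≗g = cong₂ _+_ (sumBelow-cong n f≗g) (f≗g n)

sumBelow-zero : ∀ n (f : ℕ → ℤ) → (∀ r → r < n → f r ≡ 0ℤ) → sumBelow n f ≡ 0ℤ
sumBelow-zero zero    f f≡0 = refl
sumBelow-zero (suc n) f f≡0
  rewrite sumBelow-zero n f (λ r r<n → f≡0 r (ℕP.m<n⇒m<1+n r<n)) | f≡0 n ℕP.≤-refl = refl

sumBelow-+ : ∀ n (f g : ℕ → ℤ) → sumBelow n (λ r → f r + g r) ≡ sumBelow n f + sumBelow n g
sumBelow-+ zero    f g = refl
sumBelow-+ (suc n) f g rewrite sumBelow-+ n f g = middle-swap (sumBelow n f) (sumBelow n g) (f n) (g n)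
  where
  middle-swap : ∀ a b c d → a + b + (c + d) ≡ a + c + (b + d)
  middle-swap = solve-∀

sumBelow-*ˡ : ∀ n x (f : ℕ → ℤ) → sumBelow n (λ r → x * f r) ≡ x * sumBelow n f
sumBelow-*ˡ zero    x f = sym (ℤP.*-zeroʳ x)
sumBelow-*ˡ (suc n) x f rewrite sumBelow-*ˡ n x f = sym (ℤP.*-distribˡ-+ x (sumBelow n f) (f n))

sumBelow-suc : ∀ n (f : ℕ → ℤ) → sumBelow (suc n) f ≡ f 0 + sumBelow n (λ r → f (suc r))
sumBelow-suc zero    f = ℤP.+-comm 0ℤ (f 0)
sumBelow-suc (suc n) f rewrite sumBelow-suc n f = ℤP.+-assoc (f 0) _ _

sumBelow-vanishing-tail : ∀ {m} n (f : ℕ → ℤ) → m ≤ n → (∀ r → m ≤ r → f r ≡ 0ℤ) →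
                          sumBelow n f ≡ sumBelow m f
sumBelow-vanishing-tail zero    f z≤n    tail≡0 = refl
sumBelow-vanishing-tail (suc n) f m≤1+n tail≡0 with ℕP.m≤n⇒m<n∨m≡n m≤1+n
... | inj₂ refl = refl
... | inj₁ m<1+n rewrite tail≡0 n (ℕP.≤-pred m<1+n) | ℤP.+-identityʳ (sumBelow n f) =
  sumBelow-vanishing-tail n f (ℕP.≤-pred m<1+n) tail≡0

sumRange≡sumBelow : ∀ j b (f : ℕ → ℤ) → (∀ r → r < j → f r ≡ 0ℤ) → sumRange j b f ≡ sumBelow (suc b) f
sumRange≡sumBelow zero          zero    f _    = refl
sumRange≡sumBelow (suc zero)    zero    f f≡0 rewrite f≡0 0 (s≤s z≤n) = refl
sumRange≡sumBelow (suc (suc j)) zero    f f≡0 rewrite f≡0 0 (s≤s z≤n) = refl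
sumRange≡sumBelow j             (suc b) f f≡0 with j ℕ.≤? suc b
... | yes j≤1+b rewrite ℕP.+-∸-assoc 1 j≤1+b | ℕP.m+[n∸m]≡n j≤1+b =
  cong (_+ f (suc b)) (sumRange≡sumBelow j b f f≡0)
... | no j≰1+b rewrite ℕP.m≤n⇒m∸n≡0 (ℕP.≰⇒> j≰1+b) =
  sym (sumBelow-zero (suc (suc b)) f (λ r r<2+b → f≡0 r (ℕP.<-≤-trans r<2+b (ℕP.≰⇒> j≰1+b))))

coeff-addP : ∀ p q r → coeff (addP p q) r ≡ coeff p r + coeff q r
coeff-addP []      q       r       = sym (ℤP.+-identityˡ _)
coeff-addP (a ∷ p) []      zero    = sym (ℤP.+-identityʳ a)
coeff-addP (a ∷ p) []      (suc r) = sym (ℤP.+-identityʳ _)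
coeff-addP (a ∷ p) (b ∷ q) zero    = refl
coeff-addP (a ∷ p) (b ∷ q) (suc r) = coeff-addP p q r

coeff-scale : ∀ x p r → coeff (scale x p) r ≡ x * coeff p r
coeff-scale x []      r       = sym (ℤP.*-zeroʳ x)
coeff-scale x (a ∷ p) zero    = refl
coeff-scale x (a ∷ p) (suc r) = coeff-scale x p r

s-suc-zero : ∀ a → s (suc a) 0 ≡ - + a * s a 0
s-suc-zero a = trans (coeff-addP (0ℤ ∷ falling a) (scale (- + a) (falling a)) 0)
                     (trans (ℤP.+-identityˡ _) (coeff-scale (- + a) (falling a) 0))

s-suc-suc : ∀ a r → s (suc a) (suc r) ≡ s a r + - + a * s a (suc r)
s-suc-suc a r = trans (coeff-addP (0ℤ ∷ falling a) (scale (- + a) (falling a)) (suc r))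
                      (cong (λ t → s a r + t) (coeff-scale (- + a) (falling a) (suc r)))

s-vanishing : ∀ {a r} → a < r → s a r ≡ 0ℤ
s-vanishing {zero}  {suc r} a<r = refl
s-vanishing {suc a} {suc r} (s≤s a<r)
  rewrite s-suc-suc a r | s-vanishing a<r | s-vanishing (ℕP.m<n⇒m<1+n a<r) | ℤP.*-zeroʳ (- + a) = refl

-- Multiplication of x(x-1)⋯(x-a+1) by (x-a), read through an arbitrary weighting w of the coefficients.
sumBelow-s-suc : ∀ n a (w : ℕ → ℤ) →
  sumBelow (suc n) (λ r → w r * s (suc a) r) ≡
  sumBelow n (λ r → w (suc r) * s a r) + - + a * sumBelow (suc n) (λ r → w r * s a r)
sumBelow-s-suc n a w = begin
    sumBelow (suc n) (λ r → w r * s (suc a) r)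
  ≡⟨ sumBelow-suc n _ ⟩
    w 0 * s (suc a) 0 + sumBelow n (λ r → w (suc r) * s (suc a) (suc r))
  ≡⟨ cong₂ _+_ (cong (w 0 *_) (s-suc-zero a)) (sumBelow-cong n expand) ⟩
    w 0 * (- + a * s a 0) + sumBelow n (λ r → lower r + - + a * upper r)
  ≡⟨ cong (λ t → w 0 * (- + a * s a 0) + t) (sumBelow-+ n lower _) ⟩
    w 0 * (- + a * s a 0) + (sumBelow n lower + sumBelow n (λ r → - + a * upper r))
  ≡⟨ cong (λ t → w 0 * (- + a * s a 0) + (sumBelow n lower + t)) (sumBelow-*ˡ n (- + a) upper) ⟩
    w 0 * (- + a * s a 0) + (sumBelow n lower + - + a * sumBelow n upper)
  ≡⟨ regroup (w 0) (s a 0) (- + a) (sumBelow n lower) (sumBelow n upper) ⟩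
    sumBelow n lower + - + a * (w 0 * s a 0 + sumBelow n upper)
  ≡⟨ cong (λ t → sumBelow n lower + - + a * t) (sym (sumBelow-suc n _)) ⟩
    sumBelow n lower + - + a * sumBelow (suc n) (λ r → w r * s a r)
  ∎
  where
  open ≡-Reasoning
  lower upper : ℕ → ℤ
  lower r = w (suc r) * s a r
  upper r = w (suc r) * s a (suc r)
  distrib : ∀ x y z t → x * (y + z * t) ≡ x * y + z * (x * t)
  distrib = solve-∀
  expand : ∀ r → w (suc r) * s (suc a) (suc r) ≡ lower r + - + a * upper r
  expand r = trans (cong (w (suc r) *_) (s-suc-suc a r)) (distrib (w (suc r)) (s a r) (- + a) (s a (suc r)))
  regroup : ∀ x y z u v → x * (z * y) + (u + z * v) ≡ u + z * (x * y + v)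
  regroup = solve-∀

weight : ℤ → ℕ → ℕ → ℤ
weight k j r = + (r C j) * (- k) ^ (r ∸ j)

weight-below : ∀ k {j r} → r < j → weight k j r ≡ 0ℤ
weight-below k r<j rewrite k>n⇒nCk≡0 r<j = refl

weight-zero-suc : ∀ k r → weight k 0 (suc r) ≡ - k * weight k 0 r
weight-zero-suc k r = lemma (- k) ((- k) ^ r)
  where
  lemma : ∀ x y → 1ℤ * (x * y) ≡ x * (1ℤ * y)
  lemma = solve-∀

-- Both sides vanish when r ≤ j; otherwise the exponent r ∸ j is a successor.
weight-lower-exponent : ∀ k j r → + (r C suc j) * (- k) ^ (r ∸ j) ≡ - k * weight k (suc j) r
weight-lower-exponent k j r with r ℕ.≤? j
... | yes r≤j rewrite k>n⇒nCk≡0 (s≤s r≤j) | ℤP.*-zeroʳ (- k) = refl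
weight-lower-exponent k j zero    | no r≰j = ⊥-elim (r≰j z≤n)
weight-lower-exponent k j (suc r) | no r≰j rewrite ℕP.+-∸-assoc 1 (ℕP.≤-pred (ℕP.≰⇒> r≰j)) =
  lemma (+ (suc r C suc j)) (- k) ((- k) ^ (r ∸ j))
  where
  lemma : ∀ c x y → c * (x * y) ≡ x * (c * y)
  lemma = solve-∀

weight-suc-suc : ∀ k j r → weight k (suc j) (suc r) ≡ weight k j r + - k * weight k (suc j) r
weight-suc-suc k j r = begin
    + (suc r C suc j) * (- k) ^ (r ∸ j)
  ≡⟨ cong (λ n → + n * (- k) ^ (r ∸ j)) (sym (nCk+nC[k+1]≡[n+1]C[k+1] r j)) ⟩
    + (r C j ℕ.+ r C suc j) * (- k) ^ (r ∸ j)
  ≡⟨ cong (_* (- k) ^ (r ∸ j)) (ℤP.pos-+ (r C j) (r C suc j)) ⟩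
    (+ (r C j) + + (r C suc j)) * (- k) ^ (r ∸ j)
  ≡⟨ ℤP.*-distribʳ-+ ((- k) ^ (r ∸ j)) (+ (r C j)) (+ (r C suc j)) ⟩
    weight k j r + + (r C suc j) * (- k) ^ (r ∸ j)
  ≡⟨ cong (λ t → weight k j r + t) (weight-lower-exponent k j r) ⟩
    weight k j r + - k * weight k (suc j) r
  ∎
  where open ≡-Reasoning

cNat≡sumBelow-suc : ∀ a j k → cNat a j k ≡ sumBelow (suc a) (λ r → weight k j r * s a r)
cNat≡sumBelow-suc a j k with a <? j
... | yes a<j = sym (sumBelow-zero (suc a) _ λ r r≤a →
                  cong (_* s a r) (weight-below k (ℕP.≤-<-trans (ℕP.≤-pred r≤a) a<j)))
... | no _    = sumRange≡sumBelow j a _ λ r r<j → cong (_* s a r) (weight-below k r<j)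

cNat≡sumBelow : ∀ {a n} j k → a < n → cNat a j k ≡ sumBelow n (λ r → weight k j r * s a r)
cNat≡sumBelow {a} {n} j k a<n = trans (cNat≡sumBelow-suc a j k)
  (sym (sumBelow-vanishing-tail n _ a<n λ r a<r →
          trans (cong (weight k j r *_) (s-vanishing a<r)) (ℤP.*-zeroʳ (weight k j r))))

cNat-suc : ∀ a j k →
  cNat (suc a) j k ≡ sumBelow (suc a) (λ r → weight k j (suc r) * s a r) + - + a * cNat a j k
cNat-suc a j k = begin
    cNat (suc a) j k
  ≡⟨ cNat≡sumBelow j k ℕP.≤-refl ⟩
    sumBelow (suc (suc a)) (λ r → weight k j r * s (suc a) r)
  ≡⟨ sumBelow-s-suc (suc a) a (weight k j) ⟩
    sumBelow (suc a) (λ r → weight k j (suc r) * s a r) + - + a * sumBelow (suc (suc a)) (λ r → weight k j r * s a r)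
  ≡⟨ cong (λ t → sumBelow (suc a) (λ r → weight k j (suc r) * s a r) + - + a * t) (sym (cNat≡sumBelow j k (ℕP.m<n⇒m<1+n (ℕP.n<1+n a)))) ⟩
    sumBelow (suc a) (λ r → weight k j (suc r) * s a r) + - + a * cNat a j k
  ∎
  where open ≡-Reasoning

cNat-suc-zero : ∀ a k → cNat (suc a) 0 k ≡ - (k + + a) * cNat a 0 k
cNat-suc-zero a k = begin
    cNat (suc a) 0 k
  ≡⟨ cNat-suc a 0 k ⟩
    sumBelow (suc a) (λ r → weight k 0 (suc r) * s a r) + - + a * cNat a 0 k
  ≡⟨ cong (_+ - + a * cNat a 0 k) (trans (sumBelow-cong (suc a) factor) (sumBelow-*ˡ (suc a) (- k) _)) ⟩
    - k * sumBelow (suc a) (λ r → weight k 0 r * s a r) + - + a * cNat a 0 k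
  ≡⟨ cong (λ t → - k * t + - + a * cNat a 0 k) (sym (cNat≡sumBelow-suc a 0 k)) ⟩
    - k * cNat a 0 k + - + a * cNat a 0 k
  ≡⟨ collect k (+ a) (cNat a 0 k) ⟩
    - (k + + a) * cNat a 0 k
  ∎
  where
  open ≡-Reasoning
  factor : ∀ r → weight k 0 (suc r) * s a r ≡ - k * (weight k 0 r * s a r)
  factor r = trans (cong (_* s a r) (weight-zero-suc k r)) (ℤP.*-assoc (- k) _ (s a r))
  collect : ∀ x y z → - x * z + - y * z ≡ - (x + y) * z
  collect = solve-∀

cNat-suc-suc : ∀ a j k → cNat (suc a) (suc j) k ≡ cNat a j k - (k + + a) * cNat a (suc j) k
cNat-suc-suc a j k = begin
    cNat (suc a) (suc j) k
  ≡⟨ cNat-suc a (suc j) k ⟩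
    sumBelow (suc a) (λ r → weight k (suc j) (suc r) * s a r) + - + a * cNat a (suc j) k
  ≡⟨ cong (_+ - + a * cNat a (suc j) k) (trans (sumBelow-cong (suc a) split) (sumBelow-+ (suc a) _ _)) ⟩
    sumBelow (suc a) (λ r → weight k j r * s a r) + sumBelow (suc a) (λ r → - k * (weight k (suc j) r * s a r))
      + - + a * cNat a (suc j) k
  ≡⟨ cong₂ (λ t u → t + u + - + a * cNat a (suc j) k)
       (sym (cNat≡sumBelow-suc a j k))
       (trans (sumBelow-*ˡ (suc a) (- k) _) (cong (- k *_) (sym (cNat≡sumBelow-suc a (suc j) k)))) ⟩
    cNat a j k + - k * cNat a (suc j) k + - + a * cNat a (suc j) k
  ≡⟨ collect (cNat a j k) k (+ a) (cNat a (suc j) k) ⟩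
    cNat a j k - (k + + a) * cNat a (suc j) k
  ∎
  where
  open ≡-Reasoning
  distrib : ∀ x y z t → (x + y * z) * t ≡ x * t + y * (z * t)
  distrib = solve-∀
  split : ∀ r → weight k (suc j) (suc r) * s a r ≡ weight k j r * s a r + - k * (weight k (suc j) r * s a r)
  split r = trans (cong (_* s a r) (weight-suc-suc k j r)) (distrib (weight k j r) (- k) (weight k (suc j) r) (s a r))
  collect : ∀ w x y z → w + - x * z + - y * z ≡ w - (x + y) * z
  collect = solve-∀

-1^[2+n] : ∀ n → (- 1ℤ) ^ (2 ℕ.+ n) ≡ (- 1ℤ) ^ n
-1^[2+n] n = lemma ((- 1ℤ) ^ n)
  where
  lemma : ∀ x → - 1ℤ * (- 1ℤ * x) ≡ x
  lemma = solve-∀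

-1^n≡-1^[n%2] : ∀ n → (- 1ℤ) ^ n ≡ (- 1ℤ) ^ (n % 2)
-1^n≡-1^[n%2] zero          = refl
-1^n≡-1^[n%2] (suc zero)    = refl
-1^n≡-1^[n%2] (suc (suc n)) = begin
    (- 1ℤ) ^ (2 ℕ.+ n)       ≡⟨ -1^[2+n] n ⟩
    (- 1ℤ) ^ n               ≡⟨ -1^n≡-1^[n%2] n ⟩
    (- 1ℤ) ^ (n % 2)         ≡⟨ cong (λ m → (- 1ℤ) ^ m) (sym ([m+n]%n≡m%n n 2)) ⟩
    (- 1ℤ) ^ ((n ℕ.+ 2) % 2) ≡⟨ cong (λ m → (- 1ℤ) ^ (m % 2)) (ℕP.+-comm n 2) ⟩
    (- 1ℤ) ^ ((2 ℕ.+ n) % 2) ∎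
  where open ≡-Reasoning

signPow≡-1^∣∣ : ∀ e → signPow e ≡ (- 1ℤ) ^ ∣ e ∣
signPow≡-1^∣∣ e with ∣ e ∣ % 2 | -1^n≡-1^[n%2] ∣ e ∣ | m%n<n ∣ e ∣ 2
... | zero          | -1^∣e∣≡1  | _ = sym -1^∣e∣≡1
... | suc zero      | -1^∣e∣≡-1 | _ = sym -1^∣e∣≡-1
... | suc (suc _)   | _         | s≤s (s≤s ())

-1^∣m⊖n∣≡-1^[m+n] : ∀ m n → (- 1ℤ) ^ ∣ m ⊖ n ∣ ≡ (- 1ℤ) ^ (m ℕ.+ n)
-1^∣m⊖n∣≡-1^[m+n] m       zero    = cong (λ k → (- 1ℤ) ^ k) (sym (ℕP.+-identityʳ m))
-1^∣m⊖n∣≡-1^[m+n] zero    (suc n) = refl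
-1^∣m⊖n∣≡-1^[m+n] (suc m) (suc n) rewrite ℤP.[1+m]⊖[1+n]≡m⊖n m n | ℕP.+-suc m n =
  trans (-1^∣m⊖n∣≡-1^[m+n] m n) (sym (-1^[2+n] (m ℕ.+ n)))

signPow-⊖ : ∀ m n → signPow (m ⊖ n) ≡ (- 1ℤ) ^ (m ℕ.+ n)
signPow-⊖ m n = trans (signPow≡-1^∣∣ (m ⊖ n)) (-1^∣m⊖n∣≡-1^[m+n] m n)

m⊖n≡-[1+n∸1+m] : ∀ {m n} → m < n → m ⊖ n ≡ -[1+ n ∸ suc m ]
m⊖n≡-[1+n∸1+m] {zero}  {suc n} _         = refl
m⊖n≡-[1+n∸1+m] {suc m} {suc n} (s≤s m<n) = trans (ℤP.[1+m]⊖[1+n]≡m⊖n m n) (m⊖n≡-[1+n∸1+m] m<n)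

+[m+n]-+n≡+m : ∀ m n → + (m ℕ.+ n) - + n ≡ + m
+[m+n]-+n≡+m m n = begin
    + (m ℕ.+ n) - + n       ≡⟨ ℤP.[+m]-[+n]≡m⊖n (m ℕ.+ n) n ⟩
    (m ℕ.+ n) ⊖ n           ≡⟨ ℤP.⊖-≥ (ℕP.m≤n+m n m) ⟩
    + (m ℕ.+ n ∸ n)         ≡⟨ cong +_ (ℕP.m+n∸n≡m m n) ⟩
    + m                     ∎
  where open ≡-Reasoning

+[m+o]-+[n+o]≡m⊖n : ∀ m n o → + (m ℕ.+ o) - + (n ℕ.+ o) ≡ m ⊖ n
+[m+o]-+[n+o]≡m⊖n m n o rewrite ℤP.[+m]-[+n]≡m⊖n (m ℕ.+ o) (n ℕ.+ o) | ℕP.+-comm m o | ℕP.+-comm n o =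
  ℤP.+-cancelˡ-⊖ o m n

c-negativeˡ : ∀ {m n} y k → m < n → c (+ m - + n) y k ≡ 0ℤ
c-negativeˡ {m} {n} y k m<n rewrite ℤP.[+m]-[+n]≡m⊖n m n | m⊖n≡-[1+n∸1+m] m<n = refl

c-negativeʳ : ∀ {m n} x k → m < n → c x (+ m - + n) k ≡ 0ℤ
c-negativeʳ {m} {n} (+ _)    k m<n rewrite ℤP.[+m]-[+n]≡m⊖n m n | m⊖n≡-[1+n∸1+m] m<n = refl
c-negativeʳ         -[1+ _ ] k m<n = refl

δ-refl : ∀ x → δ x x ≡ 1ℤ
δ-refl x with x ℤ.≟ x
... | yes _  = refl
... | no x≢x = ⊥-elim (x≢x refl)

δ-≢ : ∀ {x y} → ¬ x ≡ y → δ x y ≡ 0ℤ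
δ-≢ {x} {y} x≢y with x ℤ.≟ y
... | yes x≡y = ⊥-elim (x≢y x≡y)
... | no _    = refl

rStirling1-diagonal : ∀ r m → rStirling1 r m r ≡ δ m (+ r)
rStirling1-diagonal zero    m = refl
rStirling1-diagonal (suc r) m with suc r <? suc r | suc r ℕ.≟ suc r
... | yes r<r | _        = ⊥-elim (ℕP.<-irrefl refl r<r)
... | no _    | yes _    = refl
... | no _    | no r≢r   = ⊥-elim (r≢r refl)

rStirling1-suc : ∀ {n r} m → r ≤ n → rStirling1 (suc n) m r ≡ + n * rStirling1 n m r + rStirling1 n (m - 1ℤ) r
rStirling1-suc {n} {r} m r≤n with suc n <? r | suc n ℕ.≟ r
... | yes n<r | _       = ⊥-elim (ℕP.<-irrefl refl (ℕP.<-trans (s≤s r≤n) n<r))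
... | no _    | yes n≡r = ⊥-elim (ℕP.<-irrefl (sym n≡r) (s≤s r≤n))
... | no _    | no _    = refl

rStirling1-below : ∀ {n r} m → n < r → rStirling1 n m r ≡ 0ℤ
rStirling1-below {zero}  {suc r} m n<r = refl
rStirling1-below {suc n} {r}     m n<r with suc n <? r
... | yes _   = refl
... | no n≮r  = ⊥-elim (n≮r n<r)

m-1<m : ∀ m → m - 1ℤ ℤ.< m
m-1<m m = ℤP.i≤pred[j]⇒i<j (ℤP.≤-reflexive (ℤP.+-comm m (- 1ℤ)))

rStirling1-vanishing : ∀ n {m r} → m ℤ.< + r → rStirling1 n m r ≡ 0ℤ
rStirling1-vanishing zero {m} {r} m<r with r ℕ.≟ 0
... | yes refl = δ-≢ (ℤP.<⇒≢ m<r)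
... | no _     = refl
rStirling1-vanishing (suc n) {m} {r} m<r with suc n <? r | suc n ℕ.≟ r
... | yes _ | _     = refl
... | no _  | yes _ = δ-≢ (ℤP.<⇒≢ m<r)
... | no _  | no _
  rewrite rStirling1-vanishing n m<r | rStirling1-vanishing n (ℤP.<-trans (m-1<m m) m<r) | ℤP.*-zeroʳ (+ n) = refl

rStirling1-offset : ∀ r a b → rStirling1 (a ℕ.+ r) (+ (b ℕ.+ r)) r ≡ (- 1ℤ) ^ (a ℕ.+ b) * cNat a b (+ r)
rStirling1-offset r zero    zero    = trans (rStirling1-diagonal r (+ r)) (δ-refl (+ r))
rStirling1-offset r zero    (suc b) = begin
    rStirling1 r (+ (suc b ℕ.+ r)) r  ≡⟨ rStirling1-diagonal r _ ⟩
    δ (+ (suc b ℕ.+ r)) (+ r)         ≡⟨ δ-≢ (λ eq → ℕP.m+1+n≢m r (trans (ℕP.+-comm r (suc b)) (ℤP.+-injective eq))) ⟩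
    0ℤ                                ≡⟨ sym (ℤP.*-zeroʳ ((- 1ℤ) ^ suc b)) ⟩
    (- 1ℤ) ^ suc b * cNat 0 (suc b) (+ r) ∎
  where open ≡-Reasoning
rStirling1-offset r (suc a) zero    = begin
    rStirling1 (suc (a ℕ.+ r)) (+ r) r
  ≡⟨ rStirling1-suc (+ r) (ℕP.m≤n+m r a) ⟩
    + (a ℕ.+ r) * rStirling1 (a ℕ.+ r) (+ r) r + rStirling1 (a ℕ.+ r) (+ r - 1ℤ) r
  ≡⟨ cong₂ (λ x y → + (a ℕ.+ r) * x + y) (rStirling1-offset r a zero) (rStirling1-vanishing (a ℕ.+ r) (m-1<m (+ r))) ⟩
    + (a ℕ.+ r) * ((- 1ℤ) ^ (a ℕ.+ 0) * cNat a 0 (+ r)) + 0ℤ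
  ≡⟨ cong (λ x → x * ((- 1ℤ) ^ (a ℕ.+ 0) * cNat a 0 (+ r)) + 0ℤ) (ℤP.pos-+ a r) ⟩
    (+ a + + r) * ((- 1ℤ) ^ (a ℕ.+ 0) * cNat a 0 (+ r)) + 0ℤ
  ≡⟨ regroup (+ a) (+ r) ((- 1ℤ) ^ (a ℕ.+ 0)) (cNat a 0 (+ r)) ⟩
    (- 1ℤ) ^ suc (a ℕ.+ 0) * (- (+ r + + a) * cNat a 0 (+ r))
  ≡⟨ cong ((- 1ℤ) ^ suc (a ℕ.+ 0) *_) (sym (cNat-suc-zero a (+ r))) ⟩
    (- 1ℤ) ^ suc (a ℕ.+ 0) * cNat (suc a) 0 (+ r)
  ∎
  where
  open ≡-Reasoning
  regroup : ∀ a r q c → (a + r) * (q * c) + 0ℤ ≡ - 1ℤ * q * (- (r + a) * c)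
  regroup = solve-∀
-- The lower index + (suc b + r) - 1ℤ of the second summand reduces to + (b + r).
rStirling1-offset r (suc a) (suc b) = begin
    rStirling1 (suc (a ℕ.+ r)) (+ (suc b ℕ.+ r)) r
  ≡⟨ rStirling1-suc (+ (suc b ℕ.+ r)) (ℕP.m≤n+m r a) ⟩
    + (a ℕ.+ r) * rStirling1 (a ℕ.+ r) (+ (suc b ℕ.+ r)) r + rStirling1 (a ℕ.+ r) (+ (b ℕ.+ r)) r
  ≡⟨ cong₂ (λ x y → + (a ℕ.+ r) * x + y) (rStirling1-offset r a (suc b)) (rStirling1-offset r a b) ⟩
    + (a ℕ.+ r) * ((- 1ℤ) ^ (a ℕ.+ suc b) * cNat a (suc b) (+ r)) + (- 1ℤ) ^ (a ℕ.+ b) * cNat a b (+ r)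
  ≡⟨ cong₂ (λ x n → x * ((- 1ℤ) ^ n * cNat a (suc b) (+ r)) + (- 1ℤ) ^ (a ℕ.+ b) * cNat a b (+ r))
       (ℤP.pos-+ a r) (ℕP.+-suc a b) ⟩
    (+ a + + r) * ((- 1ℤ) ^ suc (a ℕ.+ b) * cNat a (suc b) (+ r)) + (- 1ℤ) ^ (a ℕ.+ b) * cNat a b (+ r)
  ≡⟨ regroup (+ a) (+ r) ((- 1ℤ) ^ (a ℕ.+ b)) (cNat a b (+ r)) (cNat a (suc b) (+ r)) ⟩
    (- 1ℤ) ^ (2 ℕ.+ (a ℕ.+ b)) * (cNat a b (+ r) - (+ r + + a) * cNat a (suc b) (+ r))
  ≡⟨ cong₂ (λ n x → (- 1ℤ) ^ suc n * x) (sym (ℕP.+-suc a b)) (sym (cNat-suc-suc a b (+ r))) ⟩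
    (- 1ℤ) ^ (suc a ℕ.+ suc b) * cNat (suc a) (suc b) (+ r)
  ∎
  where
  open ≡-Reasoning
  regroup : ∀ a r q c₀ c₁ → (a + r) * (- 1ℤ * q * c₁) + q * c₀ ≡ - 1ℤ * (- 1ℤ * q) * (c₀ - (r + a) * c₁)
  regroup = solve-∀

theorem2p9 : (i j r : ℕ) →
    rStirling1 i (+ j) r ≡ signPow (+ i - + j) * c (+ i - + r) (+ j - + r) (+ r)
theorem2p9 i j r with r ℕ.≤? i | r ℕ.≤? j
... | no r≰i  | _ = trans (rStirling1-below (+ j) (ℕP.≰⇒> r≰i))
  (sym (trans (cong (sign *_) (c-negativeˡ (+ j - + r) (+ r) (ℕP.≰⇒> r≰i))) (ℤP.*-zeroʳ sign)))
  where sign = signPow (+ i - + j)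
... | yes _   | no r≰j = trans (rStirling1-vanishing i (ℤ.+<+ (ℕP.≰⇒> r≰j)))
  (sym (trans (cong (sign *_) (c-negativeʳ (+ i - + r) (+ r) (ℕP.≰⇒> r≰j))) (ℤP.*-zeroʳ sign)))
  where sign = signPow (+ i - + j)
... | yes r≤i | yes r≤j with i ∸ r | ℕP.m∸n+n≡m r≤i | j ∸ r | ℕP.m∸n+n≡m r≤j
... | a | refl | b | refl = begin
    rStirling1 (a ℕ.+ r) (+ (b ℕ.+ r)) r
  ≡⟨ rStirling1-offset r a b ⟩
    (- 1ℤ) ^ (a ℕ.+ b) * cNat a b (+ r)
  ≡⟨ cong (_* cNat a b (+ r)) (sym (signPow-⊖ a b)) ⟩
    signPow (a ⊖ b) * c (+ a) (+ b) (+ r)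
  ≡⟨ cong₂ _*_ (cong signPow (sym (+[m+o]-+[n+o]≡m⊖n a b r)))
               (sym (cong₂ (λ x y → c x y (+ r)) (+[m+n]-+n≡+m a r) (+[m+n]-+n≡+m b r))) ⟩
    signPow (+ (a ℕ.+ r) - + (b ℕ.+ r)) * c (+ (a ℕ.+ r) - + r) (+ (b ℕ.+ r) - + r) (+ r)
  ∎
  where open ≡-Reasoning
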